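{- There exist real matrices $D$ (of size $9\times 3$), $C$ (of size $3\times 9$) and $E$ (of size $9\times 9$) with $DC=E$ such that there are no rational matrices $D^*$, $C^*$, $E^*$ with $\mathrm{sgn}(D^*)=\mathrm{sgn}(D)$, $\mathrm{sgn}(C^*)=\mathrm{sgn}(C)$, $\mathrm{sgn}(E^*)=\mathrm{sgn}(E)$ and $D^*C^*=E^*$.
   Context: For a real matrix $B$, $\mathrm{sgn}(B)$ denotes the matrix over $\{+,-,0\}$ obtained by replacing each positive entry of $B$ by $+$, each negative entry by $-$, and each zero entry by $0$. A rational matrix is a matrix all of whose entries are rational numbers. -}

module Defs where

open import Data.Nat using (ℕ; zero; suc)
open import Data.Fin using (Fin; zero; suc)
open import Data.Product using (Σ; ∃; _×_; _,_)
open import Data.Sum using (_⊎_)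
open import Data.Empty using (⊥)
open import Relation.Nullary using (¬_)
open import Relation.Binary using (Tri; tri<; tri≈; tri>)
open import Relation.Binary.PropositionalEquality using (_≡_)
import Data.Rational as Q
open import Data.Rational using (ℚ)

data Sign : Set where
  pos neg zer : Sign

-- Axiomatic model of the real numbers: a Dedekind-complete ordered field
-- (every such structure is isomorphic to ℝ).
record RealField : Set₁ where
  infixl 6 _+_
  infixl 7 _*_
  infix 4 _<_ _≤_
  field
    Carrier : Set
    0# 1# : Carrier
    _+_ _*_ : Carrier → Carrier → Carrier
    -_ : Carrier → Carrier
    _<_ : Carrier → Carrier → Set
    +-assoc : ∀ x y z → (x + y) + z ≡ x + (y + z)
    +-comm : ∀ x y → x + y ≡ y + x
    +-identityˡ : ∀ x → 0# + x ≡ x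
    -‿inverseˡ : ∀ x → (- x) + x ≡ 0#
    *-assoc : ∀ x y z → (x * y) * z ≡ x * (y * z)
    *-comm : ∀ x y → x * y ≡ y * x
    *-identityˡ : ∀ x → 1# * x ≡ x
    distribˡ : ∀ x y z → x * (y + z) ≡ (x * y) + (x * z)
    0≢1 : ¬ (0# ≡ 1#)
    *-inverse : ∀ x → ¬ (x ≡ 0#) → ∃ λ y → y * x ≡ 1#
    <-irrefl : ∀ x → ¬ (x < x)
    <-trans : ∀ x y z → x < y → y < z → x < z
    <-cmp : ∀ x y → Tri (x < y) (x ≡ y) (y < x)
    +-mono-< : ∀ x y z → x < y → x + z < y + z
    *-pos : ∀ x y → 0# < x → 0# < y → 0# < x * y

  _≤_ : Carrier → Carrier → Set
  x ≤ y = (x < y) ⊎ (x ≡ y)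

  field
    lub : (P : Carrier → Set) → (∃ λ x → P x) → (∃ λ b → ∀ x → P x → x ≤ b) →
          ∃ λ s → (∀ x → P x → x ≤ s) × (∀ b → (∀ x → P x → x ≤ b) → s ≤ b)

Mat : Set → ℕ → ℕ → Set
Mat A m n = Fin m → Fin n → A

sumFin : {A : Set} → A → (A → A → A) → (n : ℕ) → (Fin n → A) → A
sumFin z _⊕_ zero f = z
sumFin z _⊕_ (suc n) f = f zero ⊕ sumFin z _⊕_ n (λ i → f (suc i))

module _ (R : RealField) where
  open RealField R

  sgnℝ : Carrier → Sign
  sgnℝ x with <-cmp 0# x
  ... | tri< _ _ _ = pos
  ... | tri≈ _ _ _ = zer
  ... | tri> _ _ _ = neg

  mulℝ : ∀ {m k n} → Mat Carrier m k → Mat Carrier k n → Mat Carrier m n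
  mulℝ {k = k} D C i j = sumFin 0# _+_ k (λ l → D i l * C l j)

sgnℚ : ℚ → Sign
sgnℚ x with Q._<?_ Q.0ℚ x | x Q.≟ Q.0ℚ
... | Relation.Nullary.yes _ | _ = pos
... | Relation.Nullary.no _ | Relation.Nullary.yes _ = zer
... | Relation.Nullary.no _ | Relation.Nullary.no _ = neg

mulℚ : ∀ {m k n} → Mat ℚ m k → Mat ℚ k n → Mat ℚ m n
mulℚ {k = k} D C i j = sumFin Q.0ℚ Q._+_ k (λ l → D i l Q.* C l j)

SameSignℝℚ : (R : RealField) → ∀ {m n} → Mat (RealField.Carrier R) m n → Mat ℚ m n → Set
SameSignℝℚ R A B = ∀ i j → sgnℝ R (A i j) ≡ sgnℚ (B i j)

module Submission where

-- Let β = (√5 − 1)/2, the positive root of β² + β = 1.  The six nonzero rows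
-- n, a, b, x, p, q of D are points of the projective plane and the seven
-- nonzero columns u, v, w, l, s, t, r of C are lines; E = DC, so Eᵢⱼ = 0
-- says that point i lies on line j.  Rational matrices D*, C*, E* = D*C*
-- with the same sign patterns have the same zero patterns, so they realise
-- the same incidences over ℚ with the same coordinates vanishing.  Projective
-- elimination then shows that X = n₂q₀ and Y = n₀q₂ ≠ 0 satisfy
-- X² + XY = Y², i.e. (2X + Y)² = 5Y², contradicting the irrationality of √5.

open import Defs
open import Data.Product using (Σ; _×_; _,_)
open import Data.Rational using (ℚ)
open import Relation.Nullary using (¬_)
open import Relation.Binary.PropositionalEquality using (_≡_; refl)

-- Algebra and order in an abstract real field, and the root β of x² + x = 1.
module RealFields where
  open import Data.Nat as ℕ using (ℕ; zero; suc)
  import Data.Nat.Properties as ℕₚ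
  open import Data.Integer as ℤ using (ℤ; -[1+_]; _⊖_)
  import Data.Integer.Properties as ℤₚ
  import Data.Sign as Sign
  open import Data.Product using (∃; _×_; _,_; proj₁; proj₂)
  open import Data.Sum using (inj₁; inj₂)
  open import Data.Empty using (⊥-elim)
  open import Data.Maybe using (Maybe; just; nothing)
  open import Relation.Nullary using (¬_; yes; no)
  open import Relation.Binary using (Tri; tri<; tri≈; tri>)
  open import Relation.Binary.PropositionalEquality
  open import Algebra.Bundles using (CommutativeRing)
  import Algebra.Properties.Ring as RingProperties
  import Algebra.Properties.Semiring.Mult.TCOptimised as SemiringMult
  import Algebra.Solver.Ring.AlmostCommutativeRing as ACR
  import Algebra.Solver.Ring as RingSolver

  -- The field axioms of a real field make it a commutative ring (with
  -- propositional equality), and the canonical map ℤ → ℝ is a ring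
  -- homomorphism; together these instantiate the standard ring solver with
  -- integer coefficients, which discharges all polynomial identities below.
  module RealFieldAlgebra (R : RealField) where
    open RealField R using (Carrier; 0#; 1#; _+_; _*_; -_)
    private module F = RealField R

    commutativeRing : CommutativeRing _ _
    commutativeRing = record
      { Carrier = Carrier ; _≈_ = _≡_ ; _+_ = _+_ ; _*_ = _*_ ; -_ = -_ ; 0# = 0# ; 1# = 1#
      ; isCommutativeRing = record
        { isRing = record
          { +-isAbelianGroup = record
            { isGroup = record
              { isMonoid = record
                { isSemigroup = record
                  { isMagma = record { isEquivalence = isEquivalence ; ∙-cong = cong₂ _+_ }
                  ; assoc = F.+-assoc }
                ; identity = F.+-identityˡ , λ x → trans (F.+-comm x 0#) (F.+-identityˡ x) }
              ; inverse = F.-‿inverseˡ , λ x → trans (F.+-comm x (- x)) (F.-‿inverseˡ x)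
              ; ⁻¹-cong = cong -_ }
            ; comm = F.+-comm }
          ; *-cong = cong₂ _*_
          ; *-assoc = F.*-assoc
          ; *-identity = F.*-identityˡ , λ x → trans (F.*-comm x 1#) (F.*-identityˡ x)
          ; distrib = F.distribˡ
                    , λ x y z → trans (F.*-comm (y + z) x)
                                  (trans (F.distribˡ x y z) (cong₂ _+_ (F.*-comm x y) (F.*-comm x z))) }
        ; *-comm = F.*-comm } }

    open CommutativeRing commutativeRing public
      using (ring; semiring; zeroˡ; zeroʳ; +-identityʳ; -‿inverseʳ; _-_)
    open RingProperties ring public
      using (-‿distribˡ-*; -‿distribʳ-*; -‿involutive; -‿+-comm; -0#≈0#)
    open SemiringMult semiring using (1+×; ×-homo-+; ×1-homo-*) renaming (_×_ to _times_)
    open ≡-Reasoning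

    fromℕ : ℕ → Carrier
    fromℕ n = n times 1#

    applySign : Sign.Sign → Carrier → Carrier
    applySign Sign.+ x = x
    applySign Sign.- x = - x

    ⟦_⟧ℤ : ℤ → Carrier
    ⟦ i ⟧ℤ = applySign (ℤ.sign i) (fromℕ ℤ.∣ i ∣)

    ⟦◃⟧ : ∀ s n → ⟦ s ℤ.◃ n ⟧ℤ ≡ applySign s (fromℕ n)
    ⟦◃⟧ Sign.+ zero    = refl
    ⟦◃⟧ Sign.- zero    = sym -0#≈0#
    ⟦◃⟧ Sign.+ (suc n) = refl
    ⟦◃⟧ Sign.- (suc n) = refl

    applySign-* : ∀ s t x y → applySign (s Sign.* t) (x * y) ≡ applySign s x * applySign t y
    applySign-* Sign.+ Sign.+ x y = refl
    applySign-* Sign.+ Sign.- x y = -‿distribʳ-* x y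
    applySign-* Sign.- Sign.+ x y = -‿distribˡ-* x y
    applySign-* Sign.- Sign.- x y = begin
      x * y             ≡⟨ sym (-‿involutive (x * y)) ⟩
      - - (x * y)       ≡⟨ cong -_ (-‿distribʳ-* x y) ⟩
      - (x * - y)       ≡⟨ -‿distribˡ-* x (- y) ⟩
      (- x) * (- y)     ∎

    ⟦*⟧ : ∀ i j → ⟦ i ℤ.* j ⟧ℤ ≡ ⟦ i ⟧ℤ * ⟦ j ⟧ℤ
    ⟦*⟧ i j = begin
      ⟦ s ℤ.◃ (ℤ.∣ i ∣ ℕ.* ℤ.∣ j ∣) ⟧ℤ            ≡⟨ ⟦◃⟧ s (ℤ.∣ i ∣ ℕ.* ℤ.∣ j ∣) ⟩
      applySign s (fromℕ (ℤ.∣ i ∣ ℕ.* ℤ.∣ j ∣))    ≡⟨ cong (applySign s) (×1-homo-* ℤ.∣ i ∣ ℤ.∣ j ∣) ⟩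
      applySign s (fromℕ ℤ.∣ i ∣ * fromℕ ℤ.∣ j ∣)  ≡⟨ applySign-* (ℤ.sign i) (ℤ.sign j) _ _ ⟩
      ⟦ i ⟧ℤ * ⟦ j ⟧ℤ                              ∎
      where s = ℤ.sign i Sign.* ℤ.sign j

    cancel-+-left : ∀ a b c → (a + b) - (a + c) ≡ b - c
    cancel-+-left a b c = begin
      (a + b) + - (a + c)    ≡⟨ cong ((a + b) +_) (sym (-‿+-comm a c)) ⟩
      (a + b) + (- a + - c)  ≡⟨ cong (_+ (- a + - c)) (F.+-comm a b) ⟩
      (b + a) + (- a + - c)  ≡⟨ F.+-assoc b a _ ⟩
      b + (a + (- a + - c))  ≡⟨ cong (b +_) (sym (F.+-assoc a (- a) (- c))) ⟩
      b + ((a - a) + - c)    ≡⟨ cong (λ t → b + (t + - c)) (-‿inverseʳ a) ⟩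
      b + (0# + - c)         ≡⟨ cong (b +_) (F.+-identityˡ (- c)) ⟩
      b - c                  ∎

    ⟦⊖⟧ : ∀ m n → ⟦ m ⊖ n ⟧ℤ ≡ fromℕ m - fromℕ n
    ⟦⊖⟧ zero    zero    = sym (-‿inverseʳ 0#)
    ⟦⊖⟧ (suc m) zero    = sym (trans (cong (fromℕ (suc m) +_) -0#≈0#) (+-identityʳ _))
    ⟦⊖⟧ zero    (suc n) = sym (F.+-identityˡ _)
    ⟦⊖⟧ (suc m) (suc n) = begin
      ⟦ suc m ⊖ suc n ⟧ℤ               ≡⟨ cong ⟦_⟧ℤ (ℤₚ.[1+m]⊖[1+n]≡m⊖n m n) ⟩
      ⟦ m ⊖ n ⟧ℤ                       ≡⟨ ⟦⊖⟧ m n ⟩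
      fromℕ m - fromℕ n                ≡⟨ cancel-+-left 1# _ _ ⟨
      (1# + fromℕ m) - (1# + fromℕ n)  ≡⟨ cong₂ _-_ (1+× m 1#) (1+× n 1#) ⟨
      fromℕ (suc m) - fromℕ (suc n)    ∎

    ⟦+⟧ : ∀ i j → ⟦ i ℤ.+ j ⟧ℤ ≡ ⟦ i ⟧ℤ + ⟦ j ⟧ℤ
    ⟦+⟧ (ℤ.+ m)  (ℤ.+ n)  = ×-homo-+ 1# m n
    ⟦+⟧ (ℤ.+ m)  -[1+ n ] = ⟦⊖⟧ m (suc n)
    ⟦+⟧ -[1+ m ] (ℤ.+ n)  = trans (⟦⊖⟧ n (suc m)) (F.+-comm _ _)
    ⟦+⟧ -[1+ m ] -[1+ n ] = begin
      - fromℕ (suc (suc m ℕ.+ n))          ≡⟨ cong (λ k → - fromℕ (suc k)) (ℕₚ.+-suc m n) ⟨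
      - fromℕ (suc m ℕ.+ suc n)            ≡⟨ cong -_ (×-homo-+ 1# (suc m) (suc n)) ⟩
      - (fromℕ (suc m) + fromℕ (suc n))    ≡⟨ -‿+-comm _ _ ⟨
      - fromℕ (suc m) + - fromℕ (suc n)    ∎

    ⟦-⟧ : ∀ i → ⟦ ℤ.- i ⟧ℤ ≡ - ⟦ i ⟧ℤ
    ⟦-⟧ (ℤ.+ zero)  = sym -0#≈0#
    ⟦-⟧ (ℤ.+ suc n) = refl
    ⟦-⟧ -[1+ n ]  = sym (-‿involutive _)

    ⟦⟧-homomorphism : ℤ.+-*-rawRing ACR.-Raw-AlmostCommutative⟶ ACR.fromCommutativeRing commutativeRing
    ⟦⟧-homomorphism = record
      { ⟦_⟧ = ⟦_⟧ℤ ; +-homo = ⟦+⟧ ; *-homo = ⟦*⟧ ; -‿homo = ⟦-⟧ ; 0-homo = refl ; 1-homo = refl }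

    -- Equal integer coefficients have equal images (the solver only needs this).
    coefficientsEqual? : ∀ i j → Maybe (⟦ i ⟧ℤ ≡ ⟦ j ⟧ℤ)
    coefficientsEqual? i j with i ℤ.≟ j
    ... | yes refl = just refl
    ... | no _     = nothing

    open RingSolver ℤ.+-*-rawRing (ACR.fromCommutativeRing commutativeRing) ⟦⟧-homomorphism coefficientsEqual? public

    lit : ∀ {n} → ℕ → Polynomial n
    lit k = con (ℤ.+ k)

    1≢0 : ¬ 1# ≡ 0#
    1≢0 1≡0 = F.0≢1 (sym 1≡0)

    -1≢0 : ¬ - 1# ≡ 0#
    -1≢0 -1≡0 = 1≢0 (trans (sym (-‿involutive 1#)) (trans (cong -_ -1≡0) -0#≈0#))

  module RealFieldOrder (R : RealField) where
    open RealField R using (0#; 1#; _+_; _*_; -_; _<_; _≤_; +-identityˡ; <-irrefl; <-trans; <-cmp; +-mono-<; *-pos; 0≢1)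
    open RealFieldAlgebra R

    <⇒0<- : ∀ {x y} → x < y → 0# < y - x
    <⇒0<- {x} {y} x<y = subst (_< y - x) (-‿inverseʳ x) (+-mono-< x y (- x) x<y)

    0<-⇒< : ∀ {x y} → 0# < y - x → x < y
    0<-⇒< {x} {y} 0<y-x = subst₂ _<_ (+-identityˡ x) (y-x+x≡y x y) (+-mono-< 0# (y - x) x 0<y-x)
      where
      y-x+x≡y : ∀ x y → (y - x) + x ≡ y
      y-x+x≡y = solve 2 (λ x y → (y :- x) :+ x := y) refl

    ≤⇒≯ : ∀ {x y} → x ≤ y → ¬ (y < x)
    ≤⇒≯ {x} {y} (inj₁ x<y) y<x = <-irrefl x (<-trans x y x x<y y<x)
    ≤⇒≯ {x} (inj₂ refl) x<x = <-irrefl x x<x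

    0<+ : ∀ {a b} → 0# < a → 0# < b → 0# < a + b
    0<+ {a} {b} 0<a 0<b =
      <-trans 0# b (a + b) 0<b (subst (_< a + b) (+-identityˡ b) (+-mono-< 0# a b 0<a))

    0<+≥ : ∀ {a b} → 0# < a → 0# ≤ b → 0# < a + b
    0<+≥ 0<a (inj₁ 0<b) = 0<+ 0<a 0<b
    0<+≥ {a} 0<a (inj₂ refl) = subst (0# <_) (sym (+-identityʳ a)) 0<a

    0≤+ : ∀ {a b} → 0# ≤ a → 0# ≤ b → 0# ≤ a + b
    0≤+ (inj₁ 0<a) 0≤b = inj₁ (0<+≥ 0<a 0≤b)
    0≤+ {b = b} (inj₂ refl) 0≤b = subst (0# ≤_) (sym (+-identityˡ b)) 0≤b

    0≤* : ∀ {a b} → 0# ≤ a → 0# ≤ b → 0# ≤ a * b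
    0≤* {a} {b} (inj₁ 0<a) (inj₁ 0<b) = inj₁ (*-pos a b 0<a 0<b)
    0≤* {a} _ (inj₂ refl) = inj₂ (sym (zeroʳ a))
    0≤* {b = b} (inj₂ refl) _ = inj₂ (sym (zeroˡ b))

    -- If 1 < 0 then 0 < −1, so 0 < (−1)(−1) = 1.
    0<1 : 0# < 1#
    0<1 with <-cmp 0# 1#
    ... | tri< 0<1 _ _ = 0<1
    ... | tri≈ _ 0≡1 _ = ⊥-elim (0≢1 0≡1)
    ... | tri> _ _ 1<0 = ⊥-elim (<-irrefl 0# (<-trans 0# 1# 0# 0<1' 1<0))
      where
      0<-1 : 0# < - 1#
      0<-1 = subst (0# <_) (+-identityˡ (- 1#)) (<⇒0<- 1<0)
      0<1' : 0# < 1#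
      0<1' = subst (0# <_) (solve 0 (:- lit 1 :* :- lit 1 := lit 1) refl) (*-pos _ _ 0<-1 0<-1)

    0<n : ∀ n → 0# < fromℕ (suc n)
    0<n zero = 0<1
    0<n (suc n) = 0<+ (0<n n) 0<1

    quarter : ∃ λ q → (q * (fromℕ 4) ≡ 1#) × (0# < q)
    quarter with RealField.*-inverse R (fromℕ 4) (λ 4≡0 → <-irrefl 0# (subst (0# <_) 4≡0 (0<n 3)))
    ... | q , q4≡1 with <-cmp 0# q
    ...   | tri< 0<q _ _ = q , q4≡1 , 0<q
    ...   | tri≈ _ 0≡q _ = ⊥-elim (0≢1 (trans (sym (zeroˡ (fromℕ 4))) (trans (cong (_* (fromℕ 4)) 0≡q) q4≡1)))
    ...   | tri> _ _ q<0 = ⊥-elim (≤⇒≯ (inj₁ 0<1) (0<-⇒< (subst (0# <_) -q4≡-1 (*-pos _ _ 0<-q (0<n 3)))))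
      where
      0<-q : 0# < - q
      0<-q = subst (0# <_) (+-identityˡ (- q)) (<⇒0<- q<0)
      -q4≡-1 : (- q) * (fromℕ 4) ≡ 0# - 1#
      -q4≡-1 = trans (sym (-‿distribˡ-* q _)) (trans (cong -_ q4≡1) (sym (+-identityˡ (- 1#))))

  -- It is the
  -- supremum s of S = {x | x² + x < 1}: if s² + s < 1 then s + ε ∈ S, and if
  -- s² + s > 1 then s − ε bounds S, for ε = |s² + s − 1| / 4.
  module GoldenRoot (R : RealField) where
    open RealField R using (Carrier; 0#; 1#; _+_; _*_; -_; _<_; _≤_; <-irrefl; <-trans; <-cmp; *-pos; lub)
    open RealFieldAlgebra R
    open RealFieldOrder R

    f : Carrier → Carrier
    f x = x * x + x

    S : Carrier → Set
    S x = f x < 1#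

    0∈S : S 0#
    0∈S = subst (_< 1#) (solve 0 (lit 0 := lit 0 :* lit 0 :+ lit 0) refl) 0<1

    S≤1 : ∀ x → S x → x ≤ 1#
    S≤1 x fx<1 with <-cmp x 1#
    ... | tri< x<1 _ _ = inj₁ x<1
    ... | tri≈ _ x≡1 _ = inj₂ x≡1
    ... | tri> _ _ 1<x = ⊥-elim (<-irrefl 1# (<-trans 1# (f x) 1# 1<fx fx<1))
      where
      0<x : 0# < x
      0<x = <-trans 0# 1# x 0<1 1<x
      1<fx : 1# < f x
      1<fx = 0<-⇒< (subst (0# <_) (solve 1 (λ x → x :* x :+ (x :- lit 1) := (x :* x :+ x) :- lit 1) refl x)
                                    (0<+ (*-pos x x 0<x 0<x) (<⇒0<- 1<x)))

    q : Carrier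
    q = proj₁ quarter

    0<q : 0# < q
    0<q = proj₂ (proj₂ quarter)

    -- Since 1 − 4q = 0, any multiple of it may be dropped.
    drop-1-4q : ∀ {l r} m → l ≡ r + m * (1# - q * fromℕ 4) → l ≡ r
    drop-1-4q {l} {r} m l≡ = begin
      l                            ≡⟨ l≡ ⟩
      r + m * (1# - q * fromℕ 4)  ≡⟨ cong (λ t → r + m * (1# - t)) (proj₁ (proj₂ quarter)) ⟩
      r + m * (1# - 1#)           ≡⟨ solve 2 (λ r m → r :+ m :* (lit 1 :- lit 1) := r) refl r m ⟩
      r                            ∎
      where open ≡-Reasoning

    goldenRoot : ∃ λ β → β * β + β ≡ 1#
    goldenRoot with lub S (0# , 0∈S) (1# , S≤1)
    ... | s , s-bounds , s-least = compare (<-cmp (f s) 1#)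
      where
      0≤s : 0# ≤ s
      0≤s = s-bounds 0# 0∈S

      0≤1-s : 0# ≤ 1# - s
      0≤1-s with s-least 1# S≤1
      ... | inj₁ s<1 = inj₁ (<⇒0<- s<1)
      ... | inj₂ s≡1 = inj₂ (sym (trans (cong (λ t → 1# - t) s≡1) (-‿inverseʳ 1#)))

      0≤fs : 0# ≤ f s
      0≤fs = 0≤+ (0≤* 0≤s 0≤s) 0≤s

      compare : Tri (f s < 1#) (f s ≡ 1#) (1# < f s) → ∃ λ β → β * β + β ≡ 1#
      compare (tri≈ _ fs≡1 _) = s , fs≡1
      compare (tri< fs<1 _ _) = ⊥-elim (≤⇒≯ (s-bounds (s + ε) s+ε∈S) s<s+ε)
        where
        ε : Carrier
        ε = (1# - f s) * q
        0<ε : 0# < ε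
        0<ε = *-pos _ q (<⇒0<- fs<1) 0<q
        s<s+ε : s < s + ε
        s<s+ε = 0<-⇒< (subst (0# <_) (solve 2 (λ s e → e := (s :+ e) :- s) refl s ε) 0<ε)
        -- 1 − f(s + ε) = ε (q (3 + f s) + 2 (1 − s))  modulo 1 − 4q
        s+ε∈S : S (s + ε)
        s+ε∈S = 0<-⇒< (subst (0# <_) (sym (drop-1-4q _ (expand s q)))
                   (*-pos ε _ 0<ε (0<+≥ (*-pos q _ 0<q (0<+≥ (0<n 2) 0≤fs)) (0≤+ 0≤1-s 0≤1-s))))
          where
          expand : ∀ s q → 1# - f (s + (1# - f s) * q)
                     ≡ ((1# - f s) * q) * (q * (fromℕ 3 + f s) + ((1# - s) + (1# - s)))
                       + ((1# - f s) * (1# + q)) * (1# - q * fromℕ 4)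
          expand = solve 2 (λ s q →
            lit 1 :- ((s :+ (lit 1 :- (s :* s :+ s)) :* q) :* (s :+ (lit 1 :- (s :* s :+ s)) :* q)
                      :+ (s :+ (lit 1 :- (s :* s :+ s)) :* q))
            := ((lit 1 :- (s :* s :+ s)) :* q) :* (q :* (lit 3 :+ (s :* s :+ s)) :+ ((lit 1 :- s) :+ (lit 1 :- s)))
               :+ ((lit 1 :- (s :* s :+ s)) :* (lit 1 :+ q)) :* (lit 1 :- q :* lit 4)) refl
      compare (tri> _ _ 1<fs) = ⊥-elim (≤⇒≯ (s-least y y-bounds) y<s)
        where
        ε y : Carrier
        ε = (f s - 1#) * q
        y = s - ε
        0<ε : 0# < ε
        0<ε = *-pos _ q (<⇒0<- 1<fs) 0<q
        y<s : y < s
        y<s = 0<-⇒< (subst (0# <_) (solve 2 (λ s e → e := s :- (s :- e)) refl s ε) 0<ε)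
        -- 2y + 1 = 2q (3 + s (3 − s))  modulo 1 − 4q
        0<2y+1 : 0# < y + y + 1#
        0<2y+1 = subst (0# <_) (sym (drop-1-4q _ (expand s q)))
                   (*-pos (q + q) _ (0<+ 0<q 0<q) (0<+≥ (0<n 2) (0≤* 0≤s (inj₁ (0<+≥ (0<n 1) 0≤1-s)))))
          where
          expand : ∀ s q → (s - (f s - 1#) * q) + (s - (f s - 1#) * q) + 1#
                     ≡ (q + q) * (fromℕ 3 + s * (fromℕ 2 + (1# - s))) + (s + s + 1#) * (1# - q * fromℕ 4)
          expand = solve 2 (λ s q →
            (s :- ((s :* s :+ s) :- lit 1) :* q) :+ (s :- ((s :* s :+ s) :- lit 1) :* q) :+ lit 1
            := (q :+ q) :* (lit 3 :+ s :* (lit 2 :+ (lit 1 :- s)))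
               :+ (s :+ s :+ lit 1) :* (lit 1 :- q :* lit 4)) refl
        -- for x > y:  f x − 1 = (x − y)((x − y) + (2y + 1)) + ε((1 + ε) + 2(1 − s))  modulo 1 − 4q
        y-bounds : ∀ x → S x → x ≤ y
        y-bounds x fx<1 with <-cmp x y
        ... | tri< x<y _ _ = inj₁ x<y
        ... | tri≈ _ x≡y _ = inj₂ x≡y
        ... | tri> _ _ y<x = ⊥-elim (<-irrefl 1# (<-trans 1# (f x) 1# 1<fx fx<1))
          where
          0<x-y : 0# < x - y
          0<x-y = <⇒0<- y<x
          1<fx : 1# < f x
          1<fx = 0<-⇒< (subst (0# <_) (sym (drop-1-4q _ (expand s q x)))
                   (0<+ (*-pos _ _ 0<x-y (0<+ 0<x-y 0<2y+1))
                        (*-pos ε _ 0<ε (0<+≥ (0<+ 0<1 0<ε) (0≤+ 0≤1-s 0≤1-s)))))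
            where
            expand : ∀ s q x → let e = (f s - 1#) * q ; z = s - e in
                     f x - 1# ≡ (x - z) * ((x - z) + (z + z + 1#)) + e * ((1# + e) + ((1# - s) + (1# - s)))
                                + (f s - 1#) * (1# - q * fromℕ 4)
            expand = solve 3 (λ s q x →
              (x :* x :+ x) :- lit 1
              := (x :- (s :- ((s :* s :+ s) :- lit 1) :* q))
                   :* ((x :- (s :- ((s :* s :+ s) :- lit 1) :* q))
                       :+ ((s :- ((s :* s :+ s) :- lit 1) :* q) :+ (s :- ((s :* s :+ s) :- lit 1) :* q) :+ lit 1))
                 :+ (((s :* s :+ s) :- lit 1) :* q) :* ((lit 1 :+ ((s :* s :+ s) :- lit 1) :* q) :+ ((lit 1 :- s) :+ (lit 1 :- s)))
                 :+ ((s :* s :+ s) :- lit 1) :* (lit 1 :- q :* lit 4)) refl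

-- √5 is irrational.
module RootFive where
  open import Data.Nat as ℕ using (ℕ; zero; suc; _*_; _<_)
  import Data.Nat.Properties as ℕₚ
  open import Data.Nat.Divisibility using (divides)
  open import Data.Nat.Primality using (prime?; euclidsLemma)
  open import Data.Nat.Induction using (<-rec)
  import Data.Nat.Solver as ℕSolver
  import Data.Integer as ℤ
  import Data.Integer.Properties as ℤₚ
  import Data.Rational as ℚ
  open import Data.Rational using (ℚ; mkℚ; toℚᵘ; 0ℚ)
  import Data.Rational.Properties as ℚₚ
  import Data.Rational.Unnormalised as ℚᵘ
  import Data.Rational.Unnormalised.Properties as ℚᵘₚ
  open import Data.Product using (∃; _×_; _,_)
  open import Data.Sum using (inj₁; inj₂)
  open import Relation.Nullary.Decidable using (from-yes)
  open import Relation.Binary.PropositionalEquality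

  5∣square : ∀ a c → a * a ≡ 5 * c → ∃ λ k → a ≡ k * 5
  5∣square a c a²≡5c with euclidsLemma a a (from-yes (prime? 5)) (divides c (trans a²≡5c (ℕₚ.*-comm 5 c)))
  ... | inj₁ (divides k a≡k5) = k , a≡k5
  ... | inj₂ (divides k a≡k5) = k , a≡k5

  -- a² = 5b² forces b = 0, by infinite descent: a = 5k, then b² = 5k²,
  -- so b = 5m with k² = 5m² and m < b.
  √5∉ℕ : ∀ b a → a * a ≡ 5 * (b * b) → b ≡ 0
  √5∉ℕ = <-rec (λ b → ∀ a → a * a ≡ 5 * (b * b) → b ≡ 0) descent
    where
    open ℕSolver.+-*-Solver

    factor-5 : ∀ a b → a * a ≡ 5 * (b * b) → ∃ λ k → (a ≡ k * 5) × (b * b ≡ 5 * (k * k))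
    factor-5 a b a²≡5b² with 5∣square a (b * b) a²≡5b²
    ... | k , refl = k , refl , ℕₚ.*-cancelˡ-≡ _ _ 5 (begin
      5 * (b * b)            ≡⟨ sym a²≡5b² ⟩
      (k * 5) * (k * 5)      ≡⟨ solve 1 (λ k → (k :* con 5) :* (k :* con 5) := con 5 :* (con 5 :* (k :* k))) refl k ⟩
      5 * (5 * (k * k))      ∎)
      where open ≡-Reasoning

    descent : ∀ b → (∀ {m} → m < b → ∀ a → a * a ≡ 5 * (m * m) → m ≡ 0) → ∀ a → a * a ≡ 5 * (b * b) → b ≡ 0
    descent b smaller a a²≡5b² with factor-5 a b a²≡5b²
    ... | k , _ , b²≡5k² with factor-5 b k b²≡5k²
    ...   | zero  , b≡0 , _     = b≡0
    ...   | suc m , b≡m5 , k²≡5m² with smaller (subst (suc m <_) (sym b≡m5) (ℕₚ.m<m*n (suc m) 5 (ℕ.s≤s (ℕ.s≤s ℕ.z≤n)))) k k²≡5m²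
    ...     | ()

  five : ℚ
  five = ℤ.+ 5 ℚ./ 1

  √5∉ℚ : ∀ W Y → W ℚ.* W ≡ five ℚ.* (Y ℚ.* Y) → Y ≡ 0ℚ
  √5∉ℚ W@(mkℚ a dW-1 _) Y@(mkℚ c dY-1 _) W²≡5Y² with unnormalised
    where
    unnormalised : toℚᵘ W ℚᵘ.* toℚᵘ W ℚᵘ.≃ toℚᵘ five ℚᵘ.* (toℚᵘ Y ℚᵘ.* toℚᵘ Y)
    unnormalised = ℚᵘₚ.≃-trans (ℚᵘₚ.≃-sym (ℚₚ.toℚᵘ-homo-* W W))
                     (ℚᵘₚ.≃-trans (ℚᵘₚ.≃-reflexive (cong toℚᵘ W²≡5Y²))
                       (ℚᵘₚ.≃-trans (ℚₚ.toℚᵘ-homo-* five (Y ℚ.* Y)) (ℚᵘₚ.*-congˡ {toℚᵘ five} (ℚₚ.toℚᵘ-homo-* Y Y))))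
  ... | ℚᵘ.*≡* cross = ℚₚ.↥p≡0⇒p≡0 Y (ℤₚ.∣i∣≡0⇒i≡0 ∣c∣≡0)
    where
    open ℕSolver.+-*-Solver
    open ≡-Reasoning
    dW dY : ℕ
    dW = suc dW-1
    dY = suc dY-1
    crossℕ : (ℤ.∣ a ∣ * ℤ.∣ a ∣) * (1 * (dY * dY)) ≡ (5 * (ℤ.∣ c ∣ * ℤ.∣ c ∣)) * (dW * dW)
    crossℕ = begin
      (ℤ.∣ a ∣ * ℤ.∣ a ∣) * (1 * (dY * dY))     ≡⟨ cong (_* (1 * (dY * dY))) (sym (ℤₚ.abs-* a a)) ⟩
      ℤ.∣ a ℤ.* a ∣ * ℤ.∣ ℤ.+ (1 * (dY * dY)) ∣   ≡⟨ sym (ℤₚ.abs-* (a ℤ.* a) _) ⟩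
      ℤ.∣ (a ℤ.* a) ℤ.* ℤ.+ (1 * (dY * dY)) ∣     ≡⟨ cong ℤ.∣_∣ cross ⟩
      ℤ.∣ (ℤ.+ 5 ℤ.* (c ℤ.* c)) ℤ.* ℤ.+ (dW * dW) ∣ ≡⟨ ℤₚ.abs-* (ℤ.+ 5 ℤ.* (c ℤ.* c)) _ ⟩
      ℤ.∣ ℤ.+ 5 ℤ.* (c ℤ.* c) ∣ * (dW * dW)       ≡⟨ cong (_* (dW * dW)) (trans (ℤₚ.abs-* (ℤ.+ 5) (c ℤ.* c)) (cong (5 *_) (ℤₚ.abs-* c c))) ⟩
      (5 * (ℤ.∣ c ∣ * ℤ.∣ c ∣)) * (dW * dW)       ∎
    squares : (ℤ.∣ a ∣ * dY) * (ℤ.∣ a ∣ * dY) ≡ 5 * ((ℤ.∣ c ∣ * dW) * (ℤ.∣ c ∣ * dW))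
    squares = begin
      (ℤ.∣ a ∣ * dY) * (ℤ.∣ a ∣ * dY)            ≡⟨ solve 2 (λ x y → (x :* y) :* (x :* y) := (x :* x) :* (con 1 :* (y :* y))) refl ℤ.∣ a ∣ dY ⟩
      (ℤ.∣ a ∣ * ℤ.∣ a ∣) * (1 * (dY * dY))      ≡⟨ crossℕ ⟩
      (5 * (ℤ.∣ c ∣ * ℤ.∣ c ∣)) * (dW * dW)      ≡⟨ solve 2 (λ x y → (con 5 :* (x :* x)) :* (y :* y) := con 5 :* ((x :* y) :* (x :* y))) refl ℤ.∣ c ∣ dW ⟩
      5 * ((ℤ.∣ c ∣ * dW) * (ℤ.∣ c ∣ * dW))      ∎
    ∣c∣≡0 : ℤ.∣ c ∣ ≡ 0
    ∣c∣≡0 = ℕₚ.m*n≡0⇒m≡0 ℤ.∣ c ∣ dW (√5∉ℕ (ℤ.∣ c ∣ * dW) (ℤ.∣ a ∣ * dY) squares)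

-- Linear algebra in ℚ³ and the impossibility of a rational golden configuration.
module RationalConfiguration where
  open RootFive using (√5∉ℚ; five)
  open import Data.Fin using (Fin)
  open import Data.Fin.Patterns
  import Data.Integer as ℤ
  import Data.Rational as ℚ
  open import Data.Rational using (ℚ; 0ℚ; 1ℚ; _+_; _*_; -_; _-_)
  import Data.Rational.Properties as ℚₚ
  open import Data.Rational.Solver using (module +-*-Solver)
  open import Data.Sum using (_⊎_; inj₁; inj₂)
  open import Relation.Nullary using (¬_)
  open import Relation.Binary.PropositionalEquality
  open +-*-Solver

  cancel : ∀ a x → ¬ (a ≡ 0ℚ) → a * x ≡ 0ℚ → x ≡ 0ℚ
  cancel a x a≢0 ax≡0 = begin
    x                ≡⟨ sym (ℚₚ.*-identityˡ x) ⟩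
    1ℚ * x           ≡⟨ cong (_* x) (sym (ℚₚ.*-inverseˡ a)) ⟩
    (ℚ.1/ a * a) * x ≡⟨ ℚₚ.*-assoc (ℚ.1/ a) a x ⟩
    ℚ.1/ a * (a * x) ≡⟨ cong (ℚ.1/ a *_) ax≡0 ⟩
    ℚ.1/ a * 0ℚ      ≡⟨ ℚₚ.*-zeroʳ (ℚ.1/ a) ⟩
    0ℚ               ∎
    where
    open ≡-Reasoning
    instance _ = ℚ.≢-nonZero a≢0

  nonzero-* : ∀ {a b} → ¬ (a ≡ 0ℚ) → ¬ (b ≡ 0ℚ) → ¬ (a * b ≡ 0ℚ)
  nonzero-* {a} {b} a≢0 b≢0 ab≡0 = b≢0 (cancel a b a≢0 ab≡0)

  combine₂ : ∀ {h₁ h₂ l} m₁ m₂ → l ≡ m₁ * h₁ + m₂ * h₂ → h₁ ≡ 0ℚ → h₂ ≡ 0ℚ → l ≡ 0ℚ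
  combine₂ m₁ m₂ l≡ refl refl = trans l≡ (solve 2 (λ a b → a :* con 0ℚ :+ b :* con 0ℚ := con 0ℚ) refl m₁ m₂)

  combine₃ : ∀ {h₁ h₂ h₃ l} m₁ m₂ m₃ → l ≡ m₁ * h₁ + m₂ * h₂ + m₃ * h₃ →
             h₁ ≡ 0ℚ → h₂ ≡ 0ℚ → h₃ ≡ 0ℚ → l ≡ 0ℚ
  combine₃ m₁ m₂ m₃ l≡ refl refl refl =
    trans l≡ (solve 3 (λ a b c → a :* con 0ℚ :+ b :* con 0ℚ :+ c :* con 0ℚ := con 0ℚ) refl m₁ m₂ m₃)

  combine₄ : ∀ {h₁ h₂ h₃ h₄ l} m₁ m₂ m₃ m₄ → l ≡ m₁ * h₁ + m₂ * h₂ + m₃ * h₃ + m₄ * h₄ →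
             h₁ ≡ 0ℚ → h₂ ≡ 0ℚ → h₃ ≡ 0ℚ → h₄ ≡ 0ℚ → l ≡ 0ℚ
  combine₄ m₁ m₂ m₃ m₄ l≡ refl refl refl refl =
    trans l≡ (solve 4 (λ a b c d → a :* con 0ℚ :+ b :* con 0ℚ :+ c :* con 0ℚ :+ d :* con 0ℚ := con 0ℚ) refl m₁ m₂ m₃ m₄)

  parallel : ∀ a₁ a₂ b₁ b₂ c₁ c₂ → a₁ * c₁ + a₂ * c₂ ≡ 0ℚ → b₁ * c₁ + b₂ * c₂ ≡ 0ℚ →
             (¬ c₁ ≡ 0ℚ) ⊎ (¬ c₂ ≡ 0ℚ) → a₁ * b₂ - a₂ * b₁ ≡ 0ℚ
  parallel a₁ a₂ b₁ b₂ c₁ c₂ a·c≡0 b·c≡0 (inj₁ c₁≢0) =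
    cancel c₁ _ c₁≢0 (combine₂ b₂ (- a₂)
      (solve 6 (λ a₁ a₂ b₁ b₂ c₁ c₂ → c₁ :* (a₁ :* b₂ :- a₂ :* b₁)
                  := b₂ :* (a₁ :* c₁ :+ a₂ :* c₂) :+ (:- a₂) :* (b₁ :* c₁ :+ b₂ :* c₂)) refl a₁ a₂ b₁ b₂ c₁ c₂)
      a·c≡0 b·c≡0)
  parallel a₁ a₂ b₁ b₂ c₁ c₂ a·c≡0 b·c≡0 (inj₂ c₂≢0) =
    cancel c₂ _ c₂≢0 (combine₂ (- b₁) a₁
      (solve 6 (λ a₁ a₂ b₁ b₂ c₁ c₂ → c₂ :* (a₁ :* b₂ :- a₂ :* b₁)
                  := (:- b₁) :* (a₁ :* c₁ :+ a₂ :* c₂) :+ a₁ :* (b₁ :* c₁ :+ b₂ :* c₂)) refl a₁ a₂ b₁ b₂ c₁ c₂)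
      a·c≡0 b·c≡0)

  Vec3 : Set
  Vec3 = Fin 3 → ℚ

  _·_ : Vec3 → Vec3 → ℚ
  u · v = sumFin 0ℚ _+_ 3 (λ k → u k * v k)

  -- mulℚ D C i j is, by definition, D i · column C j.
  column : ∀ {n} → Mat ℚ 3 n → Fin n → Vec3
  column C j k = C k j

  minor : Fin 3 → Fin 3 → Vec3 → Vec3 → ℚ
  minor i j a b = a i * b j - a j * b i

  ·-off₀ : ∀ (a c : Vec3) → c 0F ≡ 0ℚ → a · c ≡ a 1F * c 1F + a 2F * c 2F
  ·-off₀ a c c₀≡0 rewrite c₀≡0 =
    solve 5 (λ a₀ a₁ a₂ c₁ c₂ → a₀ :* con 0ℚ :+ (a₁ :* c₁ :+ (a₂ :* c₂ :+ con 0ℚ)) := a₁ :* c₁ :+ a₂ :* c₂) refl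
      (a 0F) (a 1F) (a 2F) (c 1F) (c 2F)

  ·-off₁ : ∀ (a c : Vec3) → c 1F ≡ 0ℚ → a · c ≡ a 0F * c 0F + a 2F * c 2F
  ·-off₁ a c c₁≡0 rewrite c₁≡0 =
    solve 5 (λ a₀ a₁ a₂ c₀ c₂ → a₀ :* c₀ :+ (a₁ :* con 0ℚ :+ (a₂ :* c₂ :+ con 0ℚ)) := a₀ :* c₀ :+ a₂ :* c₂) refl
      (a 0F) (a 1F) (a 2F) (c 0F) (c 2F)

  ·-off₂ : ∀ (a c : Vec3) → c 2F ≡ 0ℚ → a · c ≡ a 0F * c 0F + a 1F * c 1F
  ·-off₂ a c c₂≡0 rewrite c₂≡0 =
    solve 5 (λ a₀ a₁ a₂ c₀ c₁ → a₀ :* c₀ :+ (a₁ :* c₁ :+ (a₂ :* con 0ℚ :+ con 0ℚ)) := a₀ :* c₀ :+ a₁ :* c₁) refl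
      (a 0F) (a 1F) (a 2F) (c 0F) (c 1F)

  minor₁₂≡0 : ∀ a b c → c 0F ≡ 0ℚ → (¬ c 1F ≡ 0ℚ) ⊎ (¬ c 2F ≡ 0ℚ) → a · c ≡ 0ℚ → b · c ≡ 0ℚ → minor 1F 2F a b ≡ 0ℚ
  minor₁₂≡0 a b c c₀≡0 c≢0 a·c≡0 b·c≡0 =
    parallel (a 1F) (a 2F) (b 1F) (b 2F) (c 1F) (c 2F)
      (trans (sym (·-off₀ a c c₀≡0)) a·c≡0) (trans (sym (·-off₀ b c c₀≡0)) b·c≡0) c≢0

  minor₀₂≡0 : ∀ a b c → c 1F ≡ 0ℚ → (¬ c 0F ≡ 0ℚ) ⊎ (¬ c 2F ≡ 0ℚ) → a · c ≡ 0ℚ → b · c ≡ 0ℚ → minor 0F 2F a b ≡ 0ℚ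
  minor₀₂≡0 a b c c₁≡0 c≢0 a·c≡0 b·c≡0 =
    parallel (a 0F) (a 2F) (b 0F) (b 2F) (c 0F) (c 2F)
      (trans (sym (·-off₁ a c c₁≡0)) a·c≡0) (trans (sym (·-off₁ b c c₁≡0)) b·c≡0) c≢0

  minor₀₁≡0 : ∀ a b c → c 2F ≡ 0ℚ → (¬ c 0F ≡ 0ℚ) ⊎ (¬ c 1F ≡ 0ℚ) → a · c ≡ 0ℚ → b · c ≡ 0ℚ → minor 0F 1F a b ≡ 0ℚ
  minor₀₁≡0 a b c c₂≡0 c≢0 a·c≡0 b·c≡0 =
    parallel (a 0F) (a 1F) (b 0F) (b 1F) (c 0F) (c 1F)
      (trans (sym (·-off₂ a c c₂≡0)) a·c≡0) (trans (sym (·-off₂ b c c₂≡0)) b·c≡0) c≢0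

  -- Three vectors orthogonal to a common nonzero vector l are linearly
  -- dependent: l_k · det(a, b, c) is a combination of a · l, b · l, c · l
  -- (the k-th row of the adjugate).
  det : Vec3 → Vec3 → Vec3 → ℚ
  det a b c = a 0F * minor 1F 2F b c - a 1F * minor 0F 2F b c + a 2F * minor 0F 1F b c

  private
    dot₃ : ∀ {n} (x₀ x₁ x₂ y₀ y₁ y₂ : Polynomial n) → Polynomial n
    dot₃ x₀ x₁ x₂ y₀ y₁ y₂ = x₀ :* y₀ :+ (x₁ :* y₁ :+ (x₂ :* y₂ :+ con 0ℚ))
    det₃ : ∀ {n} (a₀ a₁ a₂ b₀ b₁ b₂ c₀ c₁ c₂ : Polynomial n) → Polynomial n
    det₃ a₀ a₁ a₂ b₀ b₁ b₂ c₀ c₁ c₂ =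
      a₀ :* (b₁ :* c₂ :- b₂ :* c₁) :- a₁ :* (b₀ :* c₂ :- b₂ :* c₀) :+ a₂ :* (b₀ :* c₁ :- b₁ :* c₀)

  dependent : ∀ a b c l → a · l ≡ 0ℚ → b · l ≡ 0ℚ → c · l ≡ 0ℚ →
              (¬ l 0F ≡ 0ℚ) ⊎ (¬ l 1F ≡ 0ℚ) ⊎ (¬ l 2F ≡ 0ℚ) → det a b c ≡ 0ℚ
  dependent a b c l a·l≡0 b·l≡0 c·l≡0 (inj₁ l₀≢0) =
    cancel (l 0F) _ l₀≢0 (combine₃ (minor 1F 2F b c) (- minor 1F 2F a c) (minor 1F 2F a b)
      (solve 12 (λ a₀ a₁ a₂ b₀ b₁ b₂ c₀ c₁ c₂ l₀ l₁ l₂ →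
         l₀ :* det₃ a₀ a₁ a₂ b₀ b₁ b₂ c₀ c₁ c₂
         := (b₁ :* c₂ :- b₂ :* c₁) :* dot₃ a₀ a₁ a₂ l₀ l₁ l₂ :+ (:- (a₁ :* c₂ :- a₂ :* c₁)) :* dot₃ b₀ b₁ b₂ l₀ l₁ l₂
            :+ (a₁ :* b₂ :- a₂ :* b₁) :* dot₃ c₀ c₁ c₂ l₀ l₁ l₂) refl
         (a 0F) (a 1F) (a 2F) (b 0F) (b 1F) (b 2F) (c 0F) (c 1F) (c 2F) (l 0F) (l 1F) (l 2F))
      a·l≡0 b·l≡0 c·l≡0)
  dependent a b c l a·l≡0 b·l≡0 c·l≡0 (inj₂ (inj₁ l₁≢0)) =
    cancel (l 1F) _ l₁≢0 (combine₃ (- minor 0F 2F b c) (minor 0F 2F a c) (- minor 0F 2F a b)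
      (solve 12 (λ a₀ a₁ a₂ b₀ b₁ b₂ c₀ c₁ c₂ l₀ l₁ l₂ →
         l₁ :* det₃ a₀ a₁ a₂ b₀ b₁ b₂ c₀ c₁ c₂
         := (:- (b₀ :* c₂ :- b₂ :* c₀)) :* dot₃ a₀ a₁ a₂ l₀ l₁ l₂ :+ (a₀ :* c₂ :- a₂ :* c₀) :* dot₃ b₀ b₁ b₂ l₀ l₁ l₂
            :+ (:- (a₀ :* b₂ :- a₂ :* b₀)) :* dot₃ c₀ c₁ c₂ l₀ l₁ l₂) refl
         (a 0F) (a 1F) (a 2F) (b 0F) (b 1F) (b 2F) (c 0F) (c 1F) (c 2F) (l 0F) (l 1F) (l 2F))
      a·l≡0 b·l≡0 c·l≡0)
  dependent a b c l a·l≡0 b·l≡0 c·l≡0 (inj₂ (inj₂ l₂≢0)) =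
    cancel (l 2F) _ l₂≢0 (combine₃ (minor 0F 1F b c) (- minor 0F 1F a c) (minor 0F 1F a b)
      (solve 12 (λ a₀ a₁ a₂ b₀ b₁ b₂ c₀ c₁ c₂ l₀ l₁ l₂ →
         l₂ :* det₃ a₀ a₁ a₂ b₀ b₁ b₂ c₀ c₁ c₂
         := (b₀ :* c₁ :- b₁ :* c₀) :* dot₃ a₀ a₁ a₂ l₀ l₁ l₂ :+ (:- (a₀ :* c₁ :- a₁ :* c₀)) :* dot₃ b₀ b₁ b₂ l₀ l₁ l₂
            :+ (a₀ :* b₁ :- a₁ :* b₀) :* dot₃ c₀ c₁ c₂ l₀ l₁ l₂) refl
         (a 0F) (a 1F) (a 2F) (b 0F) (b 1F) (b 2F) (c 0F) (c 1F) (c 2F) (l 0F) (l 1F) (l 2F))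
      a·l≡0 b·l≡0 c·l≡0)

  det-sparse : ∀ (a b c : Vec3) → a 0F ≡ 0ℚ → b 1F ≡ 0ℚ →
               det a b c ≡ a 1F * b 2F * c 0F + a 2F * b 0F * c 1F - a 1F * b 0F * c 2F
  det-sparse a b c a₀≡0 b₁≡0 rewrite a₀≡0 | b₁≡0 =
    solve 7 (λ a₁ a₂ b₀ b₂ c₀ c₁ c₂ →
      con 0ℚ :* (con 0ℚ :* c₂ :- b₂ :* c₁) :- a₁ :* (b₀ :* c₂ :- b₂ :* c₀) :+ a₂ :* (b₀ :* c₁ :- con 0ℚ :* c₀)
      := a₁ :* b₂ :* c₀ :+ a₂ :* b₀ :* c₁ :- a₁ :* b₀ :* c₂) refl
      (a 1F) (a 2F) (b 0F) (b 2F) (c 0F) (c 1F) (c 2F)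

  -- The golden ratio is irrational: X² + XY − Y² = 0 in ℚ forces Y = 0,
  -- because (2X + Y)² = 5Y² + 4(X² + XY − Y²).
  noRationalGoldenRatio : ∀ X Y → X * X + X * Y - Y * Y ≡ 0ℚ → Y ≡ 0ℚ
  noRationalGoldenRatio X Y golden = √5∉ℚ (X + X + Y) Y (begin
    (X + X + Y) * (X + X + Y)                    ≡⟨ solve 2 (λ X Y → (X :+ X :+ Y) :* (X :+ X :+ Y)
                                                       := con five :* (Y :* Y) :+ con four :* (X :* X :+ X :* Y :- Y :* Y)) refl X Y ⟩
    five * (Y * Y) + four * (X * X + X * Y - Y * Y) ≡⟨ cong (λ t → five * (Y * Y) + four * t) golden ⟩
    five * (Y * Y) + four * 0ℚ                   ≡⟨ solve 1 (λ y → con five :* y :+ con four :* con 0ℚ := con five :* y) refl (Y * Y) ⟩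
    five * (Y * Y)                               ∎)
    where
    open ≡-Reasoning
    four : ℚ
    four = ℤ.+ 4 ℚ./ 1

  record GoldenConfiguration (D : Mat ℚ 9 3) (C : Mat ℚ 3 9) : Set where
    field
      -- a and b lie on coordinate lines; u, v, w, s, t, r pass through coordinate points
      D₁₀ : D 1F 0F ≡ 0ℚ
      D₂₁ : D 2F 1F ≡ 0ℚ
      C₂₀ : C 2F 0F ≡ 0ℚ
      C₁₁ : C 1F 1F ≡ 0ℚ
      C₀₂ : C 0F 2F ≡ 0ℚ
      C₂₄ : C 2F 4F ≡ 0ℚ
      C₀₅ : C 0F 5F ≡ 0ℚ
      C₁₆ : C 1F 6F ≡ 0ℚ
      D₀₀≢0 : ¬ D 0F 0F ≡ 0ℚ
      D₀₁≢0 : ¬ D 0F 1F ≡ 0ℚ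
      D₁₁≢0 : ¬ D 1F 1F ≡ 0ℚ
      D₂₀≢0 : ¬ D 2F 0F ≡ 0ℚ
      D₃₂≢0 : ¬ D 3F 2F ≡ 0ℚ
      D₄₀≢0 : ¬ D 4F 0F ≡ 0ℚ
      D₅₂≢0 : ¬ D 5F 2F ≡ 0ℚ
      C₀₀≢0 : ¬ C 0F 0F ≡ 0ℚ
      C₀₁≢0 : ¬ C 0F 1F ≡ 0ℚ
      C₁₂≢0 : ¬ C 1F 2F ≡ 0ℚ
      C₀₃≢0 : ¬ C 0F 3F ≡ 0ℚ
      C₁₄≢0 : ¬ C 1F 4F ≡ 0ℚ
      C₁₅≢0 : ¬ C 1F 5F ≡ 0ℚ
      C₀₆≢0 : ¬ C 0F 6F ≡ 0ℚ
      -- incidences  n, q ∈ u;  n, b, p ∈ v;  n, a ∈ w;  a, b, x ∈ l;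
      --             x, p ∈ s;  p, q ∈ t;  q, x ∈ r
      E₀₀ : D 0F · column C 0F ≡ 0ℚ
      E₅₀ : D 5F · column C 0F ≡ 0ℚ
      E₀₁ : D 0F · column C 1F ≡ 0ℚ
      E₂₁ : D 2F · column C 1F ≡ 0ℚ
      E₄₁ : D 4F · column C 1F ≡ 0ℚ
      E₀₂ : D 0F · column C 2F ≡ 0ℚ
      E₁₂ : D 1F · column C 2F ≡ 0ℚ
      E₁₃ : D 1F · column C 3F ≡ 0ℚ
      E₂₃ : D 2F · column C 3F ≡ 0ℚ
      E₃₃ : D 3F · column C 3F ≡ 0ℚ
      E₃₄ : D 3F · column C 4F ≡ 0ℚ
      E₄₄ : D 4F · column C 4F ≡ 0ℚ
      E₄₅ : D 4F · column C 5F ≡ 0ℚ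
      E₅₅ : D 5F · column C 5F ≡ 0ℚ
      E₅₆ : D 5F · column C 6F ≡ 0ℚ
      E₃₆ : D 3F · column C 6F ≡ 0ℚ

  -- Each line through a coordinate point
  -- makes a 2×2 minor vanish, the line l makes det(a, b, x) vanish, and
  -- eliminating a, b, then p, then x leaves the golden-ratio relation.
  noRationalGoldenConfiguration : ∀ {D C} → ¬ GoldenConfiguration D C
  noRationalGoldenConfiguration {D} {C} G = D₅₂≢0 (cancel (n 0F) (q 2F) D₀₀≢0 (noRationalGoldenRatio X Y golden-difference))
    where
    open GoldenConfiguration G
    n a b x p q : Vec3
    n = D 0F
    a = D 1F
    b = D 2F
    x = D 3F
    p = D 4F
    q = D 5F

    nq-on-u : minor 0F 1F n q ≡ 0ℚ
    nq-on-u = minor₀₁≡0 n q (column C 0F) C₂₀ (inj₁ C₀₀≢0) E₀₀ E₅₀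
    np-on-v : minor 0F 2F n p ≡ 0ℚ
    np-on-v = minor₀₂≡0 n p (column C 1F) C₁₁ (inj₁ C₀₁≢0) E₀₁ E₄₁
    nb-on-v : minor 0F 2F n b ≡ 0ℚ
    nb-on-v = minor₀₂≡0 n b (column C 1F) C₁₁ (inj₁ C₀₁≢0) E₀₁ E₂₁
    na-on-w : minor 1F 2F n a ≡ 0ℚ
    na-on-w = minor₁₂≡0 n a (column C 2F) C₀₂ (inj₁ C₁₂≢0) E₀₂ E₁₂
    xp-on-s : minor 0F 1F x p ≡ 0ℚ
    xp-on-s = minor₀₁≡0 x p (column C 4F) C₂₄ (inj₂ C₁₄≢0) E₃₄ E₄₄
    pq-on-t : minor 1F 2F p q ≡ 0ℚ
    pq-on-t = minor₁₂≡0 p q (column C 5F) C₀₅ (inj₁ C₁₅≢0) E₄₅ E₅₅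
    qx-on-r : minor 0F 2F q x ≡ 0ℚ
    qx-on-r = minor₀₂≡0 q x (column C 6F) C₁₆ (inj₁ C₀₆≢0) E₅₆ E₃₆
    abx-on-l : a 1F * b 2F * x 0F + a 2F * b 0F * x 1F - a 1F * b 0F * x 2F ≡ 0ℚ
    abx-on-l = trans (sym (det-sparse a b x D₁₀ D₂₁)) (dependent a b x (column C 3F) E₁₃ E₂₃ E₃₃ (inj₁ C₀₃≢0))

    -- a ∥ (0, n₁, n₂) and b ∥ (n₀, 0, n₂), so x lies on the line through these
    x-on-ab : n 1F * n 2F * x 0F + n 0F * n 2F * x 1F - n 0F * n 1F * x 2F ≡ 0ℚ
    x-on-ab = cancel (a 1F * b 0F) _ (nonzero-* D₁₁≢0 D₂₀≢0)
      (combine₃ (n 0F * n 1F) (- (a 1F * n 1F * x 0F)) (- (b 0F * n 0F * x 1F))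
        (solve 10 (λ n₀ n₁ n₂ a₁ a₂ b₀ b₂ x₀ x₁ x₂ →
          (a₁ :* b₀) :* (n₁ :* n₂ :* x₀ :+ n₀ :* n₂ :* x₁ :- n₀ :* n₁ :* x₂)
          := (n₀ :* n₁) :* (a₁ :* b₂ :* x₀ :+ a₂ :* b₀ :* x₁ :- a₁ :* b₀ :* x₂)
             :+ (:- (a₁ :* n₁ :* x₀)) :* (n₀ :* b₂ :- n₂ :* b₀)
             :+ (:- (b₀ :* n₀ :* x₁)) :* (n₁ :* a₂ :- n₂ :* a₁)) refl
          (n 0F) (n 1F) (n 2F) (a 1F) (a 2F) (b 0F) (b 2F) (x 0F) (x 1F) (x 2F))
        abx-on-l nb-on-v na-on-w)

    -- eliminating p from the lines s, t, v
    p-eliminated : x 1F * q 2F * n 0F - x 0F * n 2F * q 1F ≡ 0ℚ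
    p-eliminated = cancel (p 0F) _ D₄₀≢0
      (combine₃ (- (q 2F * n 0F)) (x 0F * n 0F) (x 0F * q 1F)
        (solve 9 (λ n₀ n₂ x₀ x₁ p₀ p₁ p₂ q₁ q₂ →
          p₀ :* (x₁ :* q₂ :* n₀ :- x₀ :* n₂ :* q₁)
          := (:- (q₂ :* n₀)) :* (x₀ :* p₁ :- x₁ :* p₀) :+ (x₀ :* n₀) :* (p₁ :* q₂ :- p₂ :* q₁)
             :+ (x₀ :* q₁) :* (n₀ :* p₂ :- n₂ :* p₀)) refl
          (n 0F) (n 2F) (x 0F) (x 1F) (p 0F) (p 1F) (p 2F) (q 1F) (q 2F))
        xp-on-s pq-on-t np-on-v)

    X Y : ℚ
    X = n 2F * q 0F
    Y = n 0F * q 2F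

    -- eliminating x using the lines u and r
    golden-difference : X * X + X * Y - Y * Y ≡ 0ℚ
    golden-difference = cancel (n 0F * n 1F * x 2F) _
      (nonzero-* (nonzero-* D₀₀≢0 D₀₁≢0) D₃₂≢0)
      (combine₄ (q 2F * q 2F * n 0F * n 0F) (- (n 0F * n 0F * n 2F * q 2F)) (- (n 0F * n 2F * n 2F * q 2F * x 0F))
                (n 0F * n 0F * n 1F * n 2F * q 2F + n 0F * n 1F * n 2F * n 2F * q 0F)
        (solve 9 (λ n₀ n₁ n₂ x₀ x₁ x₂ q₀ q₁ q₂ →
          (n₀ :* n₁ :* x₂) :* ((n₂ :* q₀) :* (n₂ :* q₀) :+ (n₂ :* q₀) :* (n₀ :* q₂) :- (n₀ :* q₂) :* (n₀ :* q₂))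
          := (q₂ :* q₂ :* n₀ :* n₀) :* (n₁ :* n₂ :* x₀ :+ n₀ :* n₂ :* x₁ :- n₀ :* n₁ :* x₂)
             :+ (:- (n₀ :* n₀ :* n₂ :* q₂)) :* (x₁ :* q₂ :* n₀ :- x₀ :* n₂ :* q₁)
             :+ (:- (n₀ :* n₂ :* n₂ :* q₂ :* x₀)) :* (n₀ :* q₁ :- n₁ :* q₀)
             :+ (n₀ :* n₀ :* n₁ :* n₂ :* q₂ :+ n₀ :* n₁ :* n₂ :* n₂ :* q₀) :* (q₀ :* x₂ :- q₂ :* x₀)) refl
          (n 0F) (n 1F) (n 2F) (x 0F) (x 1F) (x 2F) (q 0F) (q 1F) (q 2F))
        x-on-ab p-eliminated nq-on-u qx-on-r)

module SignPatterns where
  import Data.Rational as ℚ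
  open import Data.Rational using (ℚ; 0ℚ)
  open import Data.Empty using (⊥-elim)
  open import Relation.Nullary using (¬_; yes; no)
  open import Relation.Binary using (tri<; tri≈; tri>)
  open import Relation.Binary.PropositionalEquality

  sgnℚ≡zer⇒≡0 : ∀ q → sgnℚ q ≡ zer → q ≡ 0ℚ
  sgnℚ≡zer⇒≡0 q sgn≡zer with ℚ._<?_ ℚ.0ℚ q | q ℚ.≟ ℚ.0ℚ
  sgnℚ≡zer⇒≡0 q ()      | yes _ | _
  sgnℚ≡zer⇒≡0 q sgn≡zer | no _  | yes q≡0 = q≡0
  sgnℚ≡zer⇒≡0 q ()      | no _  | no _

  sgnℚ0≡zer : sgnℚ 0ℚ ≡ zer
  sgnℚ0≡zer = refl

  module SignTransfer (R : RealField) where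
    open RealField R using (Carrier; 0#; <-irrefl; <-cmp)

    sgnℝ≡zer⇒≡0 : ∀ x → sgnℝ R x ≡ zer → x ≡ 0#
    sgnℝ≡zer⇒≡0 x sgn≡zer with <-cmp 0# x
    sgnℝ≡zer⇒≡0 x ()      | tri< _ _ _
    sgnℝ≡zer⇒≡0 x sgn≡zer | tri≈ _ 0≡x _ = sym 0≡x
    sgnℝ≡zer⇒≡0 x ()      | tri> _ _ _

    sgnℝ0≡zer : sgnℝ R 0# ≡ zer
    sgnℝ0≡zer with <-cmp 0# 0#
    ... | tri< 0<0 _ _ = ⊥-elim (<-irrefl 0# 0<0)
    ... | tri≈ _ _ _   = refl
    ... | tri> _ _ 0<0 = ⊥-elim (<-irrefl 0# 0<0)

    zero-transfer : ∀ {m n} {A : Mat Carrier m n} {B : Mat ℚ m n} → SameSignℝℚ R A B →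
                    ∀ i j → A i j ≡ 0# → B i j ≡ 0ℚ
    zero-transfer {A = A} {B} same i j A≡0 =
      sgnℚ≡zer⇒≡0 (B i j) (trans (sym (same i j)) (subst (λ t → sgnℝ R t ≡ zer) (sym A≡0) sgnℝ0≡zer))

    nonzero-transfer : ∀ {m n} {A : Mat Carrier m n} {B : Mat ℚ m n} → SameSignℝℚ R A B →
                       ∀ i j → ¬ A i j ≡ 0# → ¬ B i j ≡ 0ℚ
    nonzero-transfer {A = A} {B} same i j A≢0 B≡0 =
      A≢0 (sgnℝ≡zer⇒≡0 (A i j) (trans (same i j) (subst (λ t → sgnℚ t ≡ zer) (sym B≡0) sgnℚ0≡zer)))

module GoldenMatrices (R : RealField) where
  open RealFields
  open RationalConfiguration using (GoldenConfiguration; _·_; column)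
  open SignPatterns
  open import Data.Fin using (Fin)
  open import Data.Fin.Patterns
  open import Data.Rational using (0ℚ)
  open import Data.Product using (proj₁; proj₂)
  open import Relation.Binary.PropositionalEquality
  open RealField R using (Carrier; 0#; 1#; _+_; _*_; -_)
  open RealFieldAlgebra R

  β : Carrier
  β = proj₁ (GoldenRoot.goldenRoot R)

  β²+β≡1 : β * β + β ≡ 1#
  β²+β≡1 = proj₂ (GoldenRoot.goldenRoot R)

  vec : Carrier → Carrier → Carrier → Fin 3 → Carrier
  vec x₀ x₁ x₂ 0F = x₀
  vec x₀ x₁ x₂ 1F = x₁
  vec x₀ x₁ x₂ 2F = x₂

  -- rows: the points n, a, b, x, p, q (padded by zero rows)
  Dℝ : Mat Carrier 9 3
  Dℝ 0F = vec 1# 1# 1#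
  Dℝ 1F = vec 0# 1# 1#
  Dℝ 2F = vec 1# 0# 1#
  Dℝ 3F = vec β (β * β) 1#
  Dℝ 4F = vec 1# β 1#
  Dℝ 5F = vec β β 1#
  Dℝ _  = vec 0# 0# 0#

  -- columns: the lines u, v, w, l, s, t, r (padded by zero columns)
  lines : Fin 9 → Fin 3 → Carrier
  lines 0F = vec 1# (- 1#) 0#
  lines 1F = vec 1# 0# (- 1#)
  lines 2F = vec 0# 1# (- 1#)
  lines 3F = vec 1# 1# (- 1#)
  lines 4F = vec β (- 1#) 0#
  lines 5F = vec 0# 1# (- β)
  lines 6F = vec 1# 0# (- β)
  lines _  = vec 0# 0# 0#

  Cℝ : Mat Carrier 3 9
  Cℝ k j = lines j k

  Eℝ : Mat Carrier 9 9
  Eℝ = mulℝ R Dℝ Cℝ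

  private
    dotᴾ : (x₀ x₁ x₂ y₀ y₁ y₂ : Polynomial 1) → Polynomial 1
    dotᴾ x₀ x₁ x₂ y₀ y₁ y₂ = x₀ :* y₀ :+ (x₁ :* y₁ :+ (x₂ :* y₂ :+ lit 0))

  E₀₀ : Eℝ 0F 0F ≡ 0#
  E₀₀ = solve 1 (λ b → dotᴾ (lit 1) (lit 1) (lit 1) (lit 1) (:- lit 1) (lit 0) := lit 0) refl β
  E₅₀ : Eℝ 5F 0F ≡ 0#
  E₅₀ = solve 1 (λ b → dotᴾ b b (lit 1) (lit 1) (:- lit 1) (lit 0) := lit 0) refl β
  E₀₁ : Eℝ 0F 1F ≡ 0#
  E₀₁ = solve 1 (λ b → dotᴾ (lit 1) (lit 1) (lit 1) (lit 1) (lit 0) (:- lit 1) := lit 0) refl β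
  E₂₁ : Eℝ 2F 1F ≡ 0#
  E₂₁ = solve 1 (λ b → dotᴾ (lit 1) (lit 0) (lit 1) (lit 1) (lit 0) (:- lit 1) := lit 0) refl β
  E₄₁ : Eℝ 4F 1F ≡ 0#
  E₄₁ = solve 1 (λ b → dotᴾ (lit 1) b (lit 1) (lit 1) (lit 0) (:- lit 1) := lit 0) refl β
  E₀₂ : Eℝ 0F 2F ≡ 0#
  E₀₂ = solve 1 (λ b → dotᴾ (lit 1) (lit 1) (lit 1) (lit 0) (lit 1) (:- lit 1) := lit 0) refl β
  E₁₂ : Eℝ 1F 2F ≡ 0#
  E₁₂ = solve 1 (λ b → dotᴾ (lit 0) (lit 1) (lit 1) (lit 0) (lit 1) (:- lit 1) := lit 0) refl β
  E₁₃ : Eℝ 1F 3F ≡ 0#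
  E₁₃ = solve 1 (λ b → dotᴾ (lit 0) (lit 1) (lit 1) (lit 1) (lit 1) (:- lit 1) := lit 0) refl β
  E₂₃ : Eℝ 2F 3F ≡ 0#
  E₂₃ = solve 1 (λ b → dotᴾ (lit 1) (lit 0) (lit 1) (lit 1) (lit 1) (:- lit 1) := lit 0) refl β
  E₃₃ : Eℝ 3F 3F ≡ 0#
  E₃₃ = begin
    Eℝ 3F 3F          ≡⟨ solve 1 (λ b → dotᴾ b (b :* b) (lit 1) (lit 1) (lit 1) (:- lit 1) := (b :* b :+ b) :- lit 1) refl β ⟩
    (β * β + β) - 1#  ≡⟨ cong (_- 1#) β²+β≡1 ⟩
    1# - 1#           ≡⟨ -‿inverseʳ 1# ⟩
    0#                ∎
    where open ≡-Reasoning
  E₃₄ : Eℝ 3F 4F ≡ 0#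
  E₃₄ = solve 1 (λ b → dotᴾ b (b :* b) (lit 1) b (:- lit 1) (lit 0) := lit 0) refl β
  E₄₄ : Eℝ 4F 4F ≡ 0#
  E₄₄ = solve 1 (λ b → dotᴾ (lit 1) b (lit 1) b (:- lit 1) (lit 0) := lit 0) refl β
  E₄₅ : Eℝ 4F 5F ≡ 0#
  E₄₅ = solve 1 (λ b → dotᴾ (lit 1) b (lit 1) (lit 0) (lit 1) (:- b) := lit 0) refl β
  E₅₅ : Eℝ 5F 5F ≡ 0#
  E₅₅ = solve 1 (λ b → dotᴾ b b (lit 1) (lit 0) (lit 1) (:- b) := lit 0) refl β
  E₅₆ : Eℝ 5F 6F ≡ 0#
  E₅₆ = solve 1 (λ b → dotᴾ b b (lit 1) (lit 1) (lit 0) (:- b) := lit 0) refl β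
  E₃₆ : Eℝ 3F 6F ≡ 0#
  E₃₆ = solve 1 (λ b → dotᴾ b (b :* b) (lit 1) (lit 1) (lit 0) (:- b) := lit 0) refl β

  open SignTransfer R

  rationalRealisation : ∀ {D* C* E*} → SameSignℝℚ R Dℝ D* → SameSignℝℚ R Cℝ C* → SameSignℝℚ R Eℝ E* →
                        (∀ i j → mulℚ D* C* i j ≡ E* i j) → GoldenConfiguration D* C*
  rationalRealisation {D*} {C*} sD sC sE D*C*≡E* = record
    { D₁₀ = zero-transfer sD 1F 0F refl
    ; D₂₁ = zero-transfer sD 2F 1F refl
    ; C₂₀ = zero-transfer sC 2F 0F refl
    ; C₁₁ = zero-transfer sC 1F 1F refl
    ; C₀₂ = zero-transfer sC 0F 2F refl
    ; C₂₄ = zero-transfer sC 2F 4F refl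
    ; C₀₅ = zero-transfer sC 0F 5F refl
    ; C₁₆ = zero-transfer sC 1F 6F refl
    ; D₀₀≢0 = nonzero-transfer sD 0F 0F 1≢0
    ; D₀₁≢0 = nonzero-transfer sD 0F 1F 1≢0
    ; D₁₁≢0 = nonzero-transfer sD 1F 1F 1≢0
    ; D₂₀≢0 = nonzero-transfer sD 2F 0F 1≢0
    ; D₃₂≢0 = nonzero-transfer sD 3F 2F 1≢0
    ; D₄₀≢0 = nonzero-transfer sD 4F 0F 1≢0
    ; D₅₂≢0 = nonzero-transfer sD 5F 2F 1≢0
    ; C₀₀≢0 = nonzero-transfer sC 0F 0F 1≢0
    ; C₀₁≢0 = nonzero-transfer sC 0F 1F 1≢0
    ; C₁₂≢0 = nonzero-transfer sC 1F 2F 1≢0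
    ; C₀₃≢0 = nonzero-transfer sC 0F 3F 1≢0
    ; C₁₄≢0 = nonzero-transfer sC 1F 4F -1≢0
    ; C₁₅≢0 = nonzero-transfer sC 1F 5F 1≢0
    ; C₀₆≢0 = nonzero-transfer sC 0F 6F 1≢0
    ; E₀₀ = incidence 0F 0F E₀₀
    ; E₅₀ = incidence 5F 0F E₅₀
    ; E₀₁ = incidence 0F 1F E₀₁
    ; E₂₁ = incidence 2F 1F E₂₁
    ; E₄₁ = incidence 4F 1F E₄₁
    ; E₀₂ = incidence 0F 2F E₀₂
    ; E₁₂ = incidence 1F 2F E₁₂
    ; E₁₃ = incidence 1F 3F E₁₃
    ; E₂₃ = incidence 2F 3F E₂₃
    ; E₃₃ = incidence 3F 3F E₃₃
    ; E₃₄ = incidence 3F 4F E₃₄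
    ; E₄₄ = incidence 4F 4F E₄₄
    ; E₄₅ = incidence 4F 5F E₄₅
    ; E₅₅ = incidence 5F 5F E₅₅
    ; E₅₆ = incidence 5F 6F E₅₆
    ; E₃₆ = incidence 3F 6F E₃₆
    }
    where
    incidence : ∀ i j → Eℝ i j ≡ 0# → D* i · column C* j ≡ 0ℚ
    incidence i j Eᵢⱼ≡0 = trans (D*C*≡E* i j) (zero-transfer sE i j Eᵢⱼ≡0)

mainTheorem1 : (R : RealField) →
    Σ (Mat (RealField.Carrier R) 9 3) λ D →
    Σ (Mat (RealField.Carrier R) 3 9) λ C →
    Σ (Mat (RealField.Carrier R) 9 9) λ E →
      (∀ i j → mulℝ R D C i j ≡ E i j) ×
      ¬ (Σ (Mat ℚ 9 3) λ D* → Σ (Mat ℚ 3 9) λ C* → Σ (Mat ℚ 9 9) λ E* →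
           SameSignℝℚ R D D* × SameSignℝℚ R C C* × SameSignℝℚ R E E* ×
           (∀ i j → mulℚ D* C* i j ≡ E* i j))
mainTheorem1 R = Dℝ , Cℝ , Eℝ , (λ i j → refl) , noRationalRealisation
  where
  open GoldenMatrices R
  noRationalRealisation : ¬ (Σ (Mat ℚ 9 3) λ D* → Σ (Mat ℚ 3 9) λ C* → Σ (Mat ℚ 9 9) λ E* →
                            SameSignℝℚ R Dℝ D* × SameSignℝℚ R Cℝ C* × SameSignℝℚ R Eℝ E* ×
                            (∀ i j → mulℚ D* C* i j ≡ E* i j))
  noRationalRealisation (D* , C* , E* , sD , sC , sE , D*C*≡E*) =
    RationalConfiguration.noRationalGoldenConfiguration (rationalRealisation sD sC sE D*C*≡E*)
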